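{- Let $m,n_1,n_2$ be positive integers with $n_1\ge m-2\ge n_2\ge 2$ and $2\mid mn_1$. If $$n_1>m-5+n_2+\frac{(n_2-1)(n_2-2)}{m-1-n_2},$$ then $r(K_{1,m-1},S(n_1,n_2))=m+n_1$.
   Context: All graphs are finite simple graphs. For graphs $G_1,G_2$, the Ramsey number $r(G_1,G_2)$ is the smallest positive integer $N$ such that for every graph $G$ on $N$ vertices, either $G$ contains a (not necessarily induced) subgraph isomorphic to $G_1$, or the complement $\overline{G}$ contains a subgraph isomorphic to $G_2$. $K_{1,m-1}$ is the star on $m$ vertices. For positive integers $n_1\ge n_2$, the double star $S(n_1,n_2)$ is the tree with vertex set $\{v_0,v_1,\ldots,v_{n_1},w_0,w_1,\ldots,w_{n_2}\}$ and edge set $\{v_0v_1,\ldots,v_0v_{n_1},v_0w_0,w_0w_1,\ldots,w_0w_{n_2}\}$. -}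

module Defs where

open import Data.Nat using (ℕ; zero; suc; _+_; _<_; _≡ᵇ_; _≤ᵇ_)
open import Data.Bool using (Bool; true; false; _∧_; _∨_; not; if_then_else_)
open import Data.Bool.Properties using (∨-comm; ∧-comm)
open import Data.Fin using (Fin; toℕ; _≟_)
open import Data.Product using (Σ; _×_)
open import Relation.Binary.PropositionalEquality using (_≡_; refl; cong₂)
open import Relation.Nullary using (¬_)
open import Relation.Nullary.Decidable using (⌊_⌋)
open import Function.Definitions using (Injective)

record Graph (n : ℕ) : Set where
  field
    adj      : Fin n → Fin n → Bool
    sym      : ∀ i j → adj i j ≡ adj j i
    loopless : ∀ i → adj i i ≡ false
open Graph public

complement : ∀ {n} → Graph n → Graph n
complement {n} G = record { adj = a ; sym = s ; loopless = l }
  where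
  a : Fin n → Fin n → Bool
  a i j = if ⌊ i ≟ j ⌋ then false else not (adj G i j)
  s : ∀ i j → a i j ≡ a j i
  s i j with i ≟ j | j ≟ i
  ... | Relation.Nullary.yes _ | Relation.Nullary.yes _ = refl
  ... | Relation.Nullary.yes refl | Relation.Nullary.no q = Data.Empty.⊥-elim (q refl)
    where import Data.Empty
  ... | Relation.Nullary.no p | Relation.Nullary.yes refl = Data.Empty.⊥-elim (p refl)
    where import Data.Empty
  ... | Relation.Nullary.no _ | Relation.Nullary.no _ = cong₂ (λ x y → not x) (sym G i j) (refl {x = true})
  l : ∀ i → a i i ≡ false
  l i with i ≟ i
  ... | Relation.Nullary.yes _ = refl
  ... | Relation.Nullary.no p = Data.Empty.⊥-elim (p refl)
    where import Data.Empty

Contains : ∀ {n k} → Graph n → Graph k → Set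
Contains {n} {k} G H =
  Σ (Fin k → Fin n) λ f →
    Injective _≡_ _≡_ f × (∀ i j → adj H i j ≡ true → adj G (f i) (f j) ≡ true)

RamseyProp : ∀ {k₁ k₂} → Graph k₁ → Graph k₂ → ℕ → Set
RamseyProp G₁ G₂ N = (G : Graph N) → Contains G G₁ ⊎' Contains (complement G) G₂
  where open import Data.Sum renaming (_⊎_ to _⊎'_)

RamseyNumberIs : ∀ {k₁ k₂} → Graph k₁ → Graph k₂ → ℕ → Set
RamseyNumberIs G₁ G₂ N =
  (0 < N) × RamseyProp G₁ G₂ N × (∀ M → 0 < M → M < N → ¬ RamseyProp G₁ G₂ M)

private
  isZ : ∀ {m} → Fin m → Bool
  isZ i = toℕ i ≡ᵇ 0

  starLoop : (b : Bool) → ((b ∨ b) ∧ not (b ∧ b)) ≡ false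
  starLoop true = refl
  starLoop false = refl

Star : (m : ℕ) → Graph m
Star m = record
  { adj = λ i j → (isZ i ∨ isZ j) ∧ not (isZ i ∧ isZ j)
  ; sym = λ i j → cong₂ (λ x y → x ∧ not y) (∨-comm (isZ i) (isZ j)) (∧-comm (isZ i) (isZ j))
  ; loopless = λ i → starLoop (isZ i)
  }

-- Double star S(n₁,n₂) on vertex set Fin (n₁ + n₂ + 2), with
-- v₀ = 0, v₁..v_{n₁} = 1..n₁, w₀ = n₁+1, w₁..w_{n₂} = n₁+2..n₁+n₂+1.
-- Directed edge relation on ℕ labels (a < b):
--   v₀ — x for 1 ≤ x ≤ n₁+1 (the v_i and w₀); w₀ — x for x ≥ n₁+2.
dsE : ℕ → ℕ → ℕ → Bool
dsE n₁ a b = ((a ≡ᵇ 0) ∧ (1 ≤ᵇ b) ∧ (b ≤ᵇ suc n₁))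
           ∨ ((a ≡ᵇ suc n₁) ∧ (suc (suc n₁) ≤ᵇ b))

private
  ≤ᵇ-suc-self : ∀ k → (suc k ≤ᵇ k) ≡ false
  ≤ᵇ-suc-self zero = refl
  ≤ᵇ-suc-self (suc zero) = refl
  ≤ᵇ-suc-self (suc (suc k)) = ≤ᵇ-suc-self (suc k)

  eqᵇ-refl : ∀ k → (k ≡ᵇ k) ≡ true
  eqᵇ-refl zero = refl
  eqᵇ-refl (suc k) = eqᵇ-refl k

  dsE-loop : ∀ n₁ a → dsE n₁ a a ≡ false
  dsE-loop n₁ zero = refl
  dsE-loop n₁ (suc a) with suc a ≡ᵇ suc n₁ in eq
  ... | false = refl
  ... | true = lemma n₁ a eq
    where
    lemma : ∀ n a → (suc a ≡ᵇ suc n) ≡ true → (suc (suc n) ≤ᵇ suc a) ≡ false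
    lemma zero zero _ = refl
    lemma (suc n) (suc a) e = lemma n a e
    lemma zero (suc a) ()
    lemma (suc n) zero ()

  orLoop : (b : Bool) → b ≡ false → (b ∨ b) ≡ false
  orLoop .false refl = refl

DoubleStar : (n₁ n₂ : ℕ) → Graph (n₁ + n₂ + 2)
DoubleStar n₁ n₂ = record
  { adj = λ i j → dsE n₁ (toℕ i) (toℕ j) ∨ dsE n₁ (toℕ j) (toℕ i)
  ; sym = λ i j → ∨-comm (dsE n₁ (toℕ i) (toℕ j)) (dsE n₁ (toℕ j) (toℕ i))
  ; loopless = λ i → orLoop _ (dsE-loop n₁ (toℕ i))
  }

-- Let G have m + n₁ vertices and contain no K_{1,m−1}, so all degrees are at most m − 2
-- and every vertex u has at least n₁ + 1 non-neighbours. Double counting the paths u – x – w with x a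
-- neighbour and w a non-neighbour of u bounds the sum of the codegrees codeg(u, w) over the
-- non-neighbours w by (m − 2)(m − 3), and the hypothesis on n₁ says precisely (m − 2)(m − 3) <
-- (n₁ + 1)(m − 1 − n₂). Hence some non-neighbour w has fewer than m − 1 − n₂ common neighbours with u.
-- In the complement, u and w are adjacent centres: w takes its n₂ leaves first among the vertices
-- adjacent to w only, then among the common ones, and the vertices left over still give u its n₁ leaves.
--
-- Write m − 2 = 2h + b with b ∈ {0, 1}. On ℤ/(m + n₁ − 1) join vertices whose difference is
-- ±1, …, ±h, or the antipode when b = 1 (then m is odd, so 2 ∣ m n₁ makes n₁ and hence the order even).
-- This graph is (m − 2)-regular and its complement is n₁-regular, so it has no K_{1,m−1} and, since
-- S(n₁, n₂) contains K_{1,n₁+1}, its complement has no S(n₁, n₂). Degrees are bounded by coding each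
-- neighbourhood injectively by small numbers; smaller orders follow by passing to induced subgraphs.

module Submission where

open import Defs renaming (sym to adj-sym)
open import Data.Bool using (Bool; true; false; _∧_; _∨_; not; T)
open import Data.Bool.Properties using (T-≡; ∧-zeroʳ; ∨-zeroʳ; ∨-comm) renaming (_≟_ to _≟ᵇ_)
open import Data.Empty using (⊥; ⊥-elim)
open import Data.Fin using (Fin; zero; suc; toℕ; _≟_; fromℕ<; inject≤; splitAt; join)
open import Data.Fin.Properties
  using (any?; suc-injective; toℕ-injective; toℕ<n; toℕ-fromℕ<; toℕ-inject≤; inject≤-injective; injective⇒≤;
         toℕ-↑ˡ; toℕ-↑ʳ; splitAt⁻¹-↑ˡ; splitAt⁻¹-↑ʳ; join-splitAt)
open import Data.Nat
  using (ℕ; zero; suc; pred; _+_; _*_; _∸_; _≤_; _<_; _⊓_; _≤?_; _<?_; _≡ᵇ_; _≤ᵇ_; z≤n; s≤s; s≤s⁻¹)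
  renaming (_≟_ to _≟ℕ_)
open import Data.Nat.Divisibility using (_∣_; divides; ∣m+n∣m⇒∣n; m∣m*n)
open import Data.Nat.Properties hiding (_≟_; suc-injective)
open import Data.Nat.Tactic.RingSolver using (solve-∀)
open import Data.Product using (Σ-syntax; _×_; _,_; proj₁; proj₂)
open import Data.Sum using (_⊎_; inj₁; inj₂; [_,_])
open import Data.Vec.Functional using (_∷_; _++_)
open import Function using (_∘_; Injective)
open import Function.Bundles using (Equivalence)
open import Relation.Binary.Definitions using (tri<; tri≈; tri>)
open import Relation.Binary.PropositionalEquality hiding ([_])
open import Relation.Nullary using (¬_; Dec; yes; no; contradiction)
open import Relation.Nullary.Decidable using (⌊_⌋; _×-dec_)
open import Algebra.Properties.CommutativeSemigroup *-commutativeSemigroup using (x∙yz≈y∙xz)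
open import Algebra.Properties.Semiring.Sum +-*-semiring
  using (sum; sum-cong-≗; sum-replicate-zero; ∑-distrib-+; ∑-comm; *-distribˡ-sum)

∧-true : ∀ {x y} → x ∧ y ≡ true → x ≡ true × y ≡ true
∧-true {true} y≡true = refl , y≡true

∨-false : ∀ {x y} → x ∨ y ≡ false → x ≡ false × y ≡ false
∨-false {false} y≡false = refl , y≡false

T-true : ∀ {b} → b ≡ true → T b
T-true = Equivalence.from T-≡

true-or-false : ∀ x → x ≡ true ⊎ x ≡ false
true-or-false true = inj₁ refl
true-or-false false = inj₂ refl

χ : Bool → ℕ
χ true = 1
χ false = 0

χ-∧ : ∀ a b → χ (a ∧ b) ≡ χ a * χ b
χ-∧ true b = sym (+-identityʳ (χ b))
χ-∧ false b = refl

χ-mono : ∀ {a b} → (a ≡ true → b ≡ true) → χ a ≤ χ b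
χ-mono {false} _ = z≤n
χ-mono {true} h rewrite h refl = ≤-refl

count : ∀ {n} → (Fin n → Bool) → ℕ
count P = sum (χ ∘ P)

sum-mono-≤ : ∀ {n} {f g : Fin n → ℕ} → (∀ x → f x ≤ g x) → sum f ≤ sum g
sum-mono-≤ {zero} _ = z≤n
sum-mono-≤ {suc n} f≤g = +-mono-≤ (f≤g zero) (sum-mono-≤ (f≤g ∘ suc))

count-singleton : ∀ {n} (y : Fin n) → count (λ x → ⌊ x ≟ y ⌋) ≡ 1
count-singleton {suc n} zero = cong suc (sum-replicate-zero n)
count-singleton {suc n} (suc y) = trans (sum-cong-≗ (λ x → χ-≟-suc x y)) (count-singleton y)
  where
  χ-≟-suc : ∀ {n} (x y : Fin n) → χ ⌊ suc x ≟ suc y ⌋ ≡ χ ⌊ x ≟ y ⌋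
  χ-≟-suc x y with x ≟ y
  ... | yes _ = refl
  ... | no _ = refl

count-true : ∀ {n} → count {n} (λ _ → true) ≡ n
count-true {zero} = refl
count-true {suc n} = cong suc (count-true {n})

count-+ : ∀ {n} {P Q R : Fin n → Bool} → (∀ x → χ (P x) ≡ χ (Q x) + χ (R x)) → count P ≡ count Q + count R
count-+ {Q = Q} {R} split = trans (sum-cong-≗ split) (∑-distrib-+ (χ ∘ Q) (χ ∘ R))

count-+-singleton : ∀ {n} {P Q R : Fin n → Bool} (y : Fin n) →
  (∀ x → χ (P x) ≡ χ (Q x) + χ (R x) + χ ⌊ x ≟ y ⌋) → count P ≡ count Q + count R + 1
count-+-singleton {P = P} {Q} {R} y split = begin
  count P                                              ≡⟨ sum-cong-≗ split ⟩
  sum (λ x → χ (Q x) + χ (R x) + χ ⌊ x ≟ y ⌋)          ≡⟨ ∑-distrib-+ (λ x → χ (Q x) + χ (R x)) _ ⟩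
  sum (λ x → χ (Q x) + χ (R x)) + count (λ x → ⌊ x ≟ y ⌋)
                                                       ≡⟨ cong₂ _+_ (∑-distrib-+ (χ ∘ Q) (χ ∘ R)) (count-singleton y) ⟩
  count Q + count R + 1                                ∎
  where open ≡-Reasoning

count-< : ∀ {n} {P Q : Fin n → Bool} (y : Fin n) → (∀ x → P x ≡ true → Q x ≡ true) →
  P y ≡ false → Q y ≡ true → count P < count Q
count-< {P = P} {Q} y P⊆Q Py Qy = begin-strict
  count P                            <⟨ m<m+n (count P) (s≤s z≤n) ⟩
  count P + 1                        ≡⟨ sym (cong (count P +_) (count-singleton y)) ⟩
  count P + count (λ x → ⌊ x ≟ y ⌋)  ≡⟨ sym (∑-distrib-+ (χ ∘ P) _) ⟩
  sum (λ x → χ (P x) + χ ⌊ x ≟ y ⌋)  ≤⟨ sum-mono-≤ point ⟩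
  count Q                            ∎
  where
  open ≤-Reasoning
  point : ∀ x → χ (P x) + χ ⌊ x ≟ y ⌋ ≤ χ (Q x)
  point x with x ≟ y
  ... | yes refl rewrite Py | Qy = ≤-refl
  ... | no _ = ≤-trans (≤-reflexive (+-identityʳ _)) (χ-mono (P⊆Q x))

sumOver : ∀ {n} → (Fin n → Bool) → (Fin n → ℕ) → ℕ
sumOver P f = sum (λ x → χ (P x) * f x)

sumOver-≥ : ∀ {n} {P : Fin n → Bool} {f : Fin n → ℕ} {s : ℕ} →
  (∀ x → P x ≡ true → s ≤ f x) → s * count P ≤ sumOver P f
sumOver-≥ {P = P} {f} {s} bound = subst (_≤ sumOver P f) (sym (*-distribˡ-sum s (χ ∘ P))) (sum-mono-≤ point)
  where
  point : ∀ x → s * χ (P x) ≤ χ (P x) * f x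
  point x with P x in Px
  ... | true = subst₂ _≤_ (sym (*-identityʳ s)) (sym (+-identityʳ (f x))) (bound x Px)
  ... | false = ≤-reflexive (*-zeroʳ s)

sumOver-≤ : ∀ {n} {P : Fin n → Bool} {f : Fin n → ℕ} {c : ℕ} →
  (∀ x → P x ≡ true → f x ≤ c) → sumOver P f ≤ c * count P
sumOver-≤ {P = P} {f} {c} bound = subst (sumOver P f ≤_) (sym (*-distribˡ-sum c (χ ∘ P))) (sum-mono-≤ point)
  where
  point : ∀ x → χ (P x) * f x ≤ c * χ (P x)
  point x with P x in Px
  ... | true = subst₂ _≤_ (sym (+-identityʳ (f x))) (sym (*-identityʳ c)) (bound x Px)
  ... | false = z≤n

double-counting : ∀ {n} (P Q : Fin n → Bool) (R : Fin n → Fin n → Bool) → (∀ x y → R x y ≡ R y x) →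
  sumOver P (λ w → count (λ x → Q x ∧ R w x)) ≡ sumOver Q (λ x → count (λ w → P w ∧ R x w))
double-counting P Q R R-sym = begin
  sum (λ w → χ (P w) * count (λ x → Q x ∧ R w x))    ≡⟨ sum-cong-≗ (λ w → *-distribˡ-sum (χ (P w)) (χ ∘ (λ x → Q x ∧ R w x))) ⟩
  sum (λ w → sum (λ x → χ (P w) * χ (Q x ∧ R w x)))  ≡⟨ ∑-comm (λ w x → χ (P w) * χ (Q x ∧ R w x)) ⟩
  sum (λ x → sum (λ w → χ (P w) * χ (Q x ∧ R w x)))  ≡⟨ sum-cong-≗ (λ x → sum-cong-≗ (λ w → swap w x)) ⟩
  sum (λ x → sum (λ w → χ (Q x) * χ (P w ∧ R x w)))  ≡⟨ sum-cong-≗ (λ x → sym (*-distribˡ-sum (χ (Q x)) (λ w → χ (P w ∧ R x w)))) ⟩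
  sum (λ x → χ (Q x) * count (λ w → P w ∧ R x w))    ∎
  where
  open ≡-Reasoning
  swap : ∀ w x → χ (P w) * χ (Q x ∧ R w x) ≡ χ (Q x) * χ (P w ∧ R x w)
  swap w x rewrite χ-∧ (Q x) (R w x) | χ-∧ (P w) (R x w) | R-sym x w =
    x∙yz≈y∙xz (χ (P w)) (χ (Q x)) (χ (R w x))

enumerate : ∀ {n} (P : Fin n → Bool) → Fin (count P) → Fin n
enumerate {suc n} P i with P zero
enumerate {suc n} P zero    | true  = zero
enumerate {suc n} P (suc i) | true  = suc (enumerate (P ∘ suc) i)
enumerate {suc n} P i       | false = suc (enumerate (P ∘ suc) i)

enumerate-sound : ∀ {n} (P : Fin n → Bool) (i : Fin (count P)) → P (enumerate P i) ≡ true
enumerate-sound {suc n} P i with P zero in P0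
enumerate-sound {suc n} P zero    | true  = P0
enumerate-sound {suc n} P (suc i) | true  = enumerate-sound (P ∘ suc) i
enumerate-sound {suc n} P i       | false = enumerate-sound (P ∘ suc) i

enumerate-injective : ∀ {n} (P : Fin n → Bool) → Injective _≡_ _≡_ (enumerate P)
enumerate-injective {suc n} P {i} {j} e with P zero
enumerate-injective {suc n} P {zero}  {zero}  e | true = refl
enumerate-injective {suc n} P {suc i} {suc j} e | true =
  cong suc (enumerate-injective (P ∘ suc) (suc-injective e))
enumerate-injective {suc n} P {i} {j} e | false = enumerate-injective (P ∘ suc) (suc-injective e)

degree : ∀ {n} → Graph n → Fin n → ℕ
degree G u = count (adj G u)

module _ {n : ℕ} (G : Graph n) where

  adj⇒≢ : ∀ {i j} → adj G i j ≡ true → i ≢ j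
  adj⇒≢ {i} Gii refl with () ← trans (sym Gii) (loopless G i)

  complement-adj : ∀ {i j} → i ≢ j → adj (complement G) i j ≡ not (adj G i j)
  complement-adj {i} {j} i≢j with i ≟ j
  ... | yes i≡j = ⊥-elim (i≢j i≡j)
  ... | no _ = refl

  ¬adj⇒complement-adj : ∀ {i j} → i ≢ j → adj G i j ≡ false → adj (complement G) i j ≡ true
  ¬adj⇒complement-adj i≢j ¬Gij = trans (complement-adj i≢j) (cong not ¬Gij)

  complement-adj⇒¬adj : ∀ {i j} → adj (complement G) i j ≡ true → adj G i j ≡ false
  complement-adj⇒¬adj {i} {j} Hij with i ≟ j | adj G i j
  complement-adj⇒¬adj () | yes _ | _
  ... | no _ | false = refl

  degree-complement : ∀ u → degree G u + degree (complement G) u + 1 ≡ n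
  degree-complement u = sym (trans (sym count-true) (count-+-singleton u point))
    where
    point : ∀ x → 1 ≡ χ (adj G u x) + χ (adj (complement G) u x) + χ ⌊ x ≟ u ⌋
    point x with x ≟ u
    ... | yes refl rewrite loopless (complement G) u | loopless G u = refl
    ... | no x≢u rewrite complement-adj (x≢u ∘ sym) with adj G u x
    ...   | true = refl
    ...   | false = refl

Contains-trans : ∀ {n k l} {G : Graph n} {H : Graph k} {F : Graph l} → Contains G H → Contains H F → Contains G F
Contains-trans (f , f-inj , f-adj) (g , g-inj , g-adj) = f ∘ g , g-inj ∘ f-inj , λ i j → f-adj (g i) (g j) ∘ g-adj i j

star-embedding : ∀ {n} (G : Graph n) (c : Fin n) {d : ℕ} → d ≤ degree G c → Contains G (Star (suc d))
star-embedding G c {d} d≤deg = f , f-inj , f-adj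
  where
  leaf : Fin d → Fin _
  leaf i = enumerate (adj G c) (inject≤ i d≤deg)
  leaf-adj : ∀ i → adj G c (leaf i) ≡ true
  leaf-adj i = enumerate-sound (adj G c) (inject≤ i d≤deg)
  f : Fin (suc d) → Fin _
  f zero = c
  f (suc i) = leaf i
  f-inj : Injective _≡_ _≡_ f
  f-inj {zero} {zero} _ = refl
  f-inj {zero} {suc j} c≡leaf = ⊥-elim (adj⇒≢ G (leaf-adj j) c≡leaf)
  f-inj {suc i} {zero} leaf≡c = ⊥-elim (adj⇒≢ G (leaf-adj i) (sym leaf≡c))
  f-inj {suc i} {suc j} e = cong suc (toℕ-injective (begin
    toℕ i                    ≡⟨ sym (toℕ-inject≤ i d≤deg) ⟩
    toℕ (inject≤ i d≤deg)    ≡⟨ cong toℕ (enumerate-injective (adj G c) e) ⟩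
    toℕ (inject≤ j d≤deg)    ≡⟨ toℕ-inject≤ j d≤deg ⟩
    toℕ j                    ∎))
    where open ≡-Reasoning
  f-adj : ∀ i j → adj (Star (suc d)) i j ≡ true → adj G (f i) (f j) ≡ true
  f-adj zero (suc j) _ = leaf-adj j
  f-adj (suc i) zero _ = trans (adj-sym G (leaf i) c) (leaf-adj i)

record NeighbourhoodCode {n : ℕ} (G : Graph n) (c : Fin n) (d : ℕ) : Set where
  field
    code     : Fin n → ℕ
    code-<   : ∀ {x} → adj G c x ≡ true → code x < d
    code-inj : ∀ {x y} → adj G c x ≡ true → adj G c y ≡ true → code x ≡ code y → x ≡ y

star-free : ∀ {n} (G : Graph n) {d : ℕ} → (∀ c → NeighbourhoodCode G c d) → ¬ Contains G (Star (2 + d))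
star-free G {d} coded (f , f-inj , f-adj) = <⇒≱ (n<1+n d) (injective⇒≤ leaf-code-inj)
  where
  open NeighbourhoodCode (coded (f zero))
  leaf-adj : ∀ i → adj G (f zero) (f (suc i)) ≡ true
  leaf-adj i = f-adj zero (suc i) refl
  leaf-code : Fin (suc d) → Fin d
  leaf-code i = fromℕ< (code-< (leaf-adj i))
  leaf-code-inj : Injective _≡_ _≡_ leaf-code
  leaf-code-inj {i} {j} e = suc-injective (f-inj (code-inj (leaf-adj i) (leaf-adj j)
    (trans (sym (toℕ-fromℕ< _)) (trans (cong toℕ e) (toℕ-fromℕ< _)))))

doubleStar⊇star : ∀ n₁ n₂ → Contains (DoubleStar n₁ n₂) (Star (2 + n₁))
doubleStar⊇star n₁ n₂ = f , inject≤-injective fits fits _ _ , f-adj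
  where
  fits : 2 + n₁ ≤ n₁ + n₂ + 2
  fits = ≤-trans (m≤m+n (2 + n₁) n₂) (≤-reflexive (+-comm 2 (n₁ + n₂)))
  f : Fin (2 + n₁) → Fin (n₁ + n₂ + 2)
  f i = inject≤ i fits
  centre-adj : ∀ (j : Fin (1 + n₁)) → dsE n₁ 0 (suc (toℕ j)) ≡ true
  centre-adj j rewrite Equivalence.to T-≡ (≤⇒≤ᵇ (toℕ<n j)) = refl
  f-adj : ∀ i j → adj (Star (2 + n₁)) i j ≡ true → adj (DoubleStar n₁ n₂) (f i) (f j) ≡ true
  f-adj zero (suc j) _ rewrite toℕ-inject≤ (suc j) fits | toℕ-inject≤ {2 + n₁} zero fits | centre-adj j = refl
  f-adj (suc i) zero _ rewrite toℕ-inject≤ (suc i) fits | toℕ-inject≤ {2 + n₁} zero fits | centre-adj i =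
    ∨-zeroʳ (dsE n₁ (suc (toℕ i)) 0)

module _ {A : Set} {m n : ℕ} (xs : Fin m → A) (ys : Fin n → A) where

  data ++-View (k : Fin (m + n)) : Set where
    left  : ∀ i → (xs ++ ys) k ≡ xs i → toℕ k ≡ toℕ i → ++-View k
    right : ∀ j → (xs ++ ys) k ≡ ys j → toℕ k ≡ m + toℕ j → ++-View k

  ++-view : ∀ k → ++-View k
  ++-view k with splitAt m k in split
  ... | inj₁ i = left i (cong [ xs , ys ] split) (trans (cong toℕ (sym (splitAt⁻¹-↑ˡ split))) (toℕ-↑ˡ i n))
  ... | inj₂ j = right j (cong [ xs , ys ] split) (trans (cong toℕ (sym (splitAt⁻¹-↑ʳ split))) (toℕ-↑ʳ m j))

  ++-injective : Injective _≡_ _≡_ xs → Injective _≡_ _≡_ ys → (∀ i j → xs i ≢ ys j) → Injective _≡_ _≡_ (xs ++ ys)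
  ++-injective xs-inj ys-inj disjoint {k} {k'} e =
    trans (sym (join-splitAt m n k)) (trans (cong (join m n) (on-parts (splitAt m k) (splitAt m k') e)) (join-splitAt m n k'))
    where
    on-parts : ∀ a b → [ xs , ys ] a ≡ [ xs , ys ] b → a ≡ b
    on-parts (inj₁ i) (inj₁ i') e = cong inj₁ (xs-inj e)
    on-parts (inj₁ i) (inj₂ j) e = ⊥-elim (disjoint i j e)
    on-parts (inj₂ j) (inj₁ i) e = ⊥-elim (disjoint i j (sym e))
    on-parts (inj₂ j) (inj₂ j') e = cong inj₂ (ys-inj e)

data DoubleStarEdge (n₁ : ℕ) : ℕ → ℕ → Set where
  spoke₁ : ∀ {i} → i < n₁ → DoubleStarEdge n₁ 0 (suc i)
  bridge : DoubleStarEdge n₁ 0 (suc n₁)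
  spoke₂ : ∀ j → DoubleStarEdge n₁ (suc n₁) (2 + n₁ + j)

dsE⇒edge : ∀ n₁ a b → dsE n₁ a b ≡ true → DoubleStarEdge n₁ a b
dsE⇒edge n₁ zero (suc b) _ with suc b ≤ᵇ suc n₁ in b≤n₁
... | true with m≤n⇒m<n∨m≡n (s≤s⁻¹ (≤ᵇ⇒≤ (suc b) (suc n₁) (T-true b≤n₁)))
...   | inj₁ b<n₁ = spoke₁ b<n₁
...   | inj₂ refl = bridge
dsE⇒edge n₁ (suc a) b _ with a ≡ᵇ n₁ in a≡n₁ | 2 + n₁ ≤ᵇ b in n₁<b
... | true | true rewrite ≡ᵇ⇒≡ a n₁ (T-true a≡n₁) =
  subst (DoubleStarEdge n₁ (suc n₁)) (m+[n∸m]≡n (≤ᵇ⇒≤ (2 + n₁) b (T-true n₁<b))) (spoke₂ (b ∸ (2 + n₁)))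

∷-injective : ∀ {A : Set} {n} {x : A} {f : Fin n → A} →
  (∀ i → f i ≢ x) → Injective _≡_ _≡_ f → Injective _≡_ _≡_ (x ∷ f)
∷-injective _ _ {Fin.zero} {Fin.zero} _ = refl
∷-injective f≢x _ {Fin.zero} {Fin.suc j} x≡fj = ⊥-elim (f≢x j (sym x≡fj))
∷-injective f≢x _ {Fin.suc i} {Fin.zero} fi≡x = ⊥-elim (f≢x i fi≡x)
∷-injective _ f-inj {Fin.suc i} {Fin.suc j} e = cong Fin.suc (f-inj e)

module _ {N : ℕ} (H : Graph N) {n₁ n₂ L : ℕ} (u w : Fin N) (leaf : Fin L → Fin N) where

  -- Label l of DoubleStar n₁ n₂ is sent to entry slot l of the list u ∷ w ∷ leaf: the w-leaves take the
  -- first n₂ entries of leaf and the u-leaves the next n₁.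
  private
    slot : ℕ → ℕ
    slot zero = 0
    slot (suc l) with l <? n₁ | l ≟ℕ n₁
    ... | yes _ | _ = 2 + (n₂ + l)
    ... | no _ | yes _ = 1
    ... | no _ | no _ = 2 + (l ∸ suc n₁)

    unslot : ℕ → ℕ
    unslot zero = 0
    unslot (suc zero) = suc n₁
    unslot (suc (suc t)) with t <? n₂
    ... | yes _ = 2 + n₁ + t
    ... | no _ = suc (t ∸ n₂)

    unslot-leaf₁ : ∀ l → unslot (2 + (n₂ + l)) ≡ suc l
    unslot-leaf₁ l with n₂ + l <? n₂
    ... | yes n₂+l<n₂ = ⊥-elim (m+n≮m n₂ l n₂+l<n₂)
    ... | no _ = cong suc (m+n∸m≡n n₂ l)

    unslot-leaf₂ : ∀ t → t < n₂ → unslot (2 + t) ≡ 2 + n₁ + t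
    unslot-leaf₂ t t<n₂ with t <? n₂
    ... | yes _ = refl
    ... | no t≮n₂ = ⊥-elim (t≮n₂ t<n₂)

    u-leaf-index : n₁ + n₂ ≤ L → ∀ {i} → i < n₁ → n₂ + i < L
    u-leaf-index room i<n₁ = <-≤-trans (+-monoʳ-< n₂ i<n₁) (subst (_≤ L) (+-comm n₁ n₂) room)

    w-leaf-index : n₁ + n₂ ≤ L → ∀ {j} → j < n₂ → j < L
    w-leaf-index room j<n₂ = <-≤-trans j<n₂ (≤-trans (m≤n+m n₂ n₁) room)

    slot-spec : n₁ + n₂ ≤ L → ∀ l → l < n₁ + n₂ + 2 → slot l < 2 + L × unslot (slot l) ≡ l
    slot-spec room zero _ = s≤s z≤n , refl
    slot-spec room (suc l) l<bound with l <? n₁ | l ≟ℕ n₁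
    ... | yes l<n₁ | _ =
      s≤s (s≤s (u-leaf-index room l<n₁)) , unslot-leaf₁ l
    ... | no _ | yes refl = s≤s (s≤s z≤n) , refl
    ... | no l≮n₁ | no l≢n₁ = s≤s (s≤s (w-leaf-index room t<n₂)) ,
      trans (unslot-leaf₂ t t<n₂) (cong suc (m+[n∸m]≡n n₁<l))
      where
      n₁<l : suc n₁ ≤ l
      n₁<l = ≤∧≢⇒< (≮⇒≥ l≮n₁) (l≢n₁ ∘ sym)
      t = l ∸ suc n₁
      t<n₂ : t < n₂
      t<n₂ = subst (t <_) (m+n∸m≡n (suc n₁) n₂)
        (∸-monoˡ-< (s≤s⁻¹ (subst (suc l <_) (+-comm (n₁ + n₂) 2) l<bound)) n₁<l)

    slot-leaf₁ : ∀ {i} → i < n₁ → slot (suc i) ≡ 2 + (n₂ + i)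
    slot-leaf₁ {i} i<n₁ with i <? n₁
    ... | yes _ = refl
    ... | no i≮n₁ = ⊥-elim (i≮n₁ i<n₁)

    slot-centre₂ : slot (suc n₁) ≡ 1
    slot-centre₂ with n₁ <? n₁ | n₁ ≟ℕ n₁
    ... | yes n₁<n₁ | _ = ⊥-elim (n≮n n₁ n₁<n₁)
    ... | no _ | yes _ = refl
    ... | no _ | no n₁≢n₁ = ⊥-elim (n₁≢n₁ refl)

    slot-leaf₂ : ∀ j → slot (2 + n₁ + j) ≡ 2 + j
    slot-leaf₂ j with suc (n₁ + j) <? n₁ | suc (n₁ + j) ≟ℕ n₁
    ... | yes 1+n₁+j<n₁ | _ = ⊥-elim (<⇒≱ 1+n₁+j<n₁ (≤-trans (m≤m+n n₁ j) (n≤1+n _)))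
    ... | no _ | yes e = ⊥-elim (m≢1+m+n n₁ (sym e))
    ... | no _ | no _ = cong (2 +_) (m+n∸m≡n n₁ j)

  doubleStar-embedding : n₁ + n₂ ≤ L → Injective _≡_ _≡_ leaf → (∀ i → leaf i ≢ u) → (∀ i → leaf i ≢ w) →
    adj H u w ≡ true → (∀ i → toℕ i < n₂ → adj H w (leaf i) ≡ true) →
    (∀ i → n₂ ≤ toℕ i → adj H u (leaf i) ≡ true) → Contains H (DoubleStar n₁ n₂)
  doubleStar-embedding room leaf-inj leaf≢u leaf≢w Huw w-leaves u-leaves = f , f-inj , f-adj
    where
    vertex : Fin (2 + L) → Fin N
    vertex = u ∷ w ∷ leaf
    vertex-inj : Injective _≡_ _≡_ vertex
    vertex-inj = ∷-injective u-fresh (∷-injective leaf≢w leaf-inj)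
      where
      u-fresh : ∀ i → (w ∷ leaf) i ≢ u
      u-fresh Fin.zero = adj⇒≢ H Huw ∘ sym
      u-fresh (Fin.suc i) = leaf≢u i
    vertexAt : (s : ℕ) → .(s < 2 + L) → Fin N
    vertexAt s s<2+L = vertex (fromℕ< s<2+L)
    vertexAt-cong : ∀ {s s'} .{p : s < 2 + L} .{p' : s' < 2 + L} → s ≡ s' → vertexAt s p ≡ vertexAt s' p'
    vertexAt-cong refl = refl
    f : Fin (n₁ + n₂ + 2) → Fin N
    f k = vertexAt (slot (toℕ k)) (proj₁ (slot-spec room (toℕ k) (toℕ<n k)))
    f-inj : Injective _≡_ _≡_ f
    f-inj {k} {k'} e = toℕ-injective (begin
      toℕ k                   ≡⟨ sym (proj₂ (slot-spec room (toℕ k) (toℕ<n k))) ⟩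
      unslot (slot (toℕ k))   ≡⟨ cong unslot slots-equal ⟩
      unslot (slot (toℕ k'))  ≡⟨ proj₂ (slot-spec room (toℕ k') (toℕ<n k')) ⟩
      toℕ k'                  ∎)
      where
      open ≡-Reasoning
      slots-equal : slot (toℕ k) ≡ slot (toℕ k')
      slots-equal = trans (sym (toℕ-fromℕ< _)) (trans (cong toℕ (vertex-inj e)) (toℕ-fromℕ< _))
    edge : ∀ {a b} → DoubleStarEdge n₁ a b → b < n₁ + n₂ + 2 → .(pa : slot a < 2 + L) .(pb : slot b < 2 + L) →
      adj H (vertexAt (slot a) pa) (vertexAt (slot b) pb) ≡ true
    edge (spoke₁ {i} i<n₁) _ _ _ = subst (λ v → adj H u v ≡ true) (vertexAt-cong {p = s≤s (s≤s q)} (sym (slot-leaf₁ i<n₁)))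
      (u-leaves _ (subst (n₂ ≤_) (sym (toℕ-fromℕ< q)) (m≤m+n n₂ i)))
      where q = u-leaf-index room i<n₁
    edge bridge _ _ _ = subst (λ v → adj H u v ≡ true) (vertexAt-cong {p = s≤s (s≤s z≤n)} (sym slot-centre₂)) Huw
    edge (spoke₂ j) b<bound _ _ = subst₂ (λ x y → adj H x y ≡ true)
      (vertexAt-cong {p = s≤s (s≤s z≤n)} (sym slot-centre₂)) (vertexAt-cong {p = s≤s (s≤s q)} (sym (slot-leaf₂ j)))
      (w-leaves _ (subst (_< n₂) (sym (toℕ-fromℕ< q)) j<n₂))
      where
      j<n₂ : j < n₂
      j<n₂ = +-cancelˡ-< (2 + n₁) j n₂ (subst (2 + n₁ + j <_) (+-comm (n₁ + n₂) 2) b<bound)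
      q = w-leaf-index room j<n₂
    f-adj : ∀ k k' → adj (DoubleStar n₁ n₂) k k' ≡ true → adj H (f k) (f k') ≡ true
    f-adj k k' e with dsE n₁ (toℕ k) (toℕ k') in kk'
    ... | true = edge (dsE⇒edge n₁ (toℕ k) (toℕ k') kk') (toℕ<n k') _ _
    ... | false = trans (adj-sym H (f k) (f k')) (edge (dsE⇒edge n₁ (toℕ k') (toℕ k) e) (toℕ<n k) _ _)

-- Upper bound

leaves-fit : ∀ {k n₁ n₂ s c α γ} → c + α + (γ + 1) + 1 ≡ 3 + k + n₁ → s + n₂ ≡ 2 + k → c < s → n₁ + n₂ ≤ α + γ
leaves-fit {k} {n₁} {n₂} {s} {c} {α} {γ} total s+n₂ c<s =
  +-cancelʳ-≤ s (n₁ + n₂) (α + γ) (≤-trans (≤-reflexive (sym balance)) (+-monoʳ-≤ (α + γ) c<s))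
  where
  open ≡-Reasoning
  balance : α + γ + suc c ≡ n₁ + n₂ + s
  balance = +-cancelʳ-≡ 2 _ _ (begin
    α + γ + suc c + 2              ≡⟨ solve α γ c ⟩
    c + α + (γ + 1) + 1 + 1        ≡⟨ cong (_+ 1) total ⟩
    3 + k + n₁ + 1                 ≡⟨ solve₂ k n₁ ⟩
    n₁ + (2 + k) + 2               ≡⟨ cong (λ t → n₁ + t + 2) (sym s+n₂) ⟩
    n₁ + (s + n₂) + 2              ≡⟨ solve₃ n₁ s n₂ ⟩
    n₁ + n₂ + s + 2                ∎)
    where
    solve : ∀ α γ c → α + γ + suc c + 2 ≡ c + α + (γ + 1) + 1 + 1
    solve = solve-∀
    solve₂ : ∀ k n₁ → 3 + k + n₁ + 1 ≡ n₁ + (2 + k) + 2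
    solve₂ = solve-∀
    solve₃ : ∀ n₁ s n₂ → n₁ + (s + n₂) + 2 ≡ n₁ + n₂ + s + 2
    solve₃ = solve-∀

module _ {k n₁ : ℕ} (G : Graph (3 + k + n₁)) (degree≤ : ∀ c → degree G c ≤ suc k) where

  private
    H = complement G

  codegree : Fin (3 + k + n₁) → Fin (3 + k + n₁) → ℕ
  codegree u w = count (λ x → adj G u x ∧ adj G w x)

  n₁<degree-complement : ∀ c → n₁ < degree H c
  n₁<degree-complement c = +-cancelˡ-< (suc k) n₁ (degree H c) (begin-strict
    suc k + n₁               <⟨ +-monoʳ-< (suc k) (n<1+n n₁) ⟩
    suc k + suc n₁           ≡⟨ +-cancelʳ-≡ 1 _ _ (trans (solve k n₁) (sym (degree-complement G c))) ⟩
    degree G c + degree H c  ≤⟨ +-monoˡ-≤ _ (degree≤ c) ⟩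
    suc k + degree H c       ∎)
    where
    open ≤-Reasoning
    solve : ∀ k n₁ → suc k + suc n₁ + 1 ≡ 3 + k + n₁
    solve = solve-∀

  codegree-sum : ∀ u → sumOver (adj H u) (codegree u) ≤ suc k * k
  codegree-sum u = begin
    sumOver (adj H u) (codegree u)                                     ≡⟨ double-counting (adj H u) (adj G u) (adj G) (adj-sym G) ⟩
    sumOver (adj G u) (λ x → count (λ w → adj H u w ∧ adj G x w))      ≤⟨ sumOver-≤ outside-u ⟩
    k * degree G u                                                     ≤⟨ *-monoʳ-≤ k (degree≤ u) ⟩
    k * suc k                                                          ≡⟨ *-comm k (suc k) ⟩
    suc k * k                                                          ∎
    where
    open ≤-Reasoning
    outside-u : ∀ x → adj G u x ≡ true → count (λ w → adj H u w ∧ adj G x w) ≤ k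
    outside-u x Gux = s≤s⁻¹ (<-≤-trans
      (count-< {P = λ w → adj H u w ∧ adj G x w} {Q = adj G x} u (λ _ → proj₂ ∘ ∧-true) (cong (_∧ adj G x u) (loopless H u))
      (trans (adj-sym G x u) Gux)) (degree≤ x))

  small-codegree : ∀ {s} → suc k * k < (n₁ + 1) * s → ∀ u → Σ[ w ∈ Fin (3 + k + n₁) ] adj H u w ≡ true × codegree u w < s
  small-codegree {s} few-common u with any? (λ w → (adj H u w ≟ᵇ true) ×-dec (codegree u w <? s))
  ... | yes found = found
  ... | no none = ⊥-elim (<⇒≱ few-common (begin
    (n₁ + 1) * s                     ≡⟨ *-comm (n₁ + 1) s ⟩
    s * (n₁ + 1)                     ≤⟨ *-monoʳ-≤ s (subst (_≤ degree H u) (+-comm 1 n₁) (n₁<degree-complement u)) ⟩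
    s * degree H u                   ≤⟨ sumOver-≥ (λ w Huw → ≮⇒≥ (λ small → none (w , Huw , small))) ⟩
    sumOver (adj H u) (codegree u)   ≤⟨ codegree-sum u ⟩
    suc k * k                        ∎))
    where open ≤-Reasoning

  module _ {n₂ s : ℕ} (n₂≤n₁ : n₂ ≤ n₁) (s+n₂ : s + n₂ ≡ 2 + k)
           {u w : Fin (3 + k + n₁)} (Huw : adj H u w ≡ true) (few-common : codegree u w < s) where

    private
      wOnly both uOnly : Fin (3 + k + n₁) → Bool
      wOnly x = adj G u x ∧ adj H w x
      both x = adj H u x ∧ adj H w x
      uOnly x = adj H u x ∧ (not (adj H w x) ∧ not ⌊ x ≟ w ⌋)
      α = count wOnly
      β = count both
      δ = count uOnly

      degree-G-u : codegree u w + α ≡ degree G u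
      degree-G-u = sym (count-+ {P = adj G u} {Q = λ x → adj G u x ∧ adj G w x} {R = wOnly} split)
        where
        split : ∀ x → χ (adj G u x) ≡ χ (adj G u x ∧ adj G w x) + χ (wOnly x)
        split x with x ≟ w
        ... | yes refl rewrite complement-adj⇒¬adj G Huw = refl
        ... | no x≢w rewrite complement-adj G {w} {x} (x≢w ∘ sym) with adj G u x | adj G w x
        ...   | true | true = refl
        ...   | true | false = refl
        ...   | false | _ = refl

      degree-H-w : degree H w ≡ α + β + 1
      degree-H-w = count-+-singleton {P = adj H w} {Q = wOnly} {R = both} u split
        where
        split : ∀ x → χ (adj H w x) ≡ χ (wOnly x) + χ (both x) + χ ⌊ x ≟ u ⌋
        split x with x ≟ u
        ... | yes refl rewrite adj-sym H w u | Huw | loopless H u | loopless G u = refl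
        ... | no x≢u rewrite complement-adj G {u} {x} (x≢u ∘ sym) with adj G u x | adj H w x
        ...   | true | true = refl
        ...   | true | false = refl
        ...   | false | true = refl
        ...   | false | false = refl

      degree-H-u : degree H u ≡ β + δ + 1
      degree-H-u = count-+-singleton {P = adj H u} {Q = both} {R = uOnly} w split
        where
        split : ∀ x → χ (adj H u x) ≡ χ (both x) + χ (uOnly x) + χ ⌊ x ≟ w ⌋
        split x with x ≟ w
        ... | yes refl rewrite Huw | loopless H w = refl
        ... | no _ with adj H u x | adj H w x
        ...   | true | true = refl
        ...   | true | false = refl
        ...   | false | _ = refl

      n₁≤α+β : n₁ ≤ α + β
      n₁≤α+β = s≤s⁻¹ (subst (n₁ <_) (trans degree-H-w (+-comm (α + β) 1)) (n₁<degree-complement w))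

      n₁≤β+δ : n₁ ≤ β + δ
      n₁≤β+δ = s≤s⁻¹ (subst (n₁ <_) (trans degree-H-u (+-comm (β + δ) 1)) (n₁<degree-complement u))

      a = α ⊓ n₂

      leaf-counts : n₂ ≤ a + β × n₁ + n₂ ≤ a + (β + δ)
      leaf-counts with ≤-total α n₂
      ... | inj₁ α≤n₂ rewrite m≤n⇒m⊓n≡m α≤n₂ = ≤-trans n₂≤n₁ n₁≤α+β ,
        leaves-fit (trans (cong₂ (λ d h → d + h + 1) degree-G-u (sym degree-H-u)) (degree-complement G u)) s+n₂ few-common
      ... | inj₂ n₂≤α rewrite m≥n⇒m⊓n≡n n₂≤α =
        m≤m+n n₂ β , subst (_≤ n₂ + (β + δ)) (+-comm n₂ n₁) (+-monoʳ-≤ n₂ n₁≤β+δ)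

      -- w's leaves: min(α, n₂) vertices of wOnly, then vertices of both; u's leaves: the rest.
      ws : Fin a → Fin (3 + k + n₁)
      ws i = enumerate wOnly (inject≤ i (m⊓n≤m α n₂))
      bs us : Fin _ → Fin (3 + k + n₁)
      bs = enumerate both
      us = enumerate uOnly
      leaves : Fin (a + (β + δ)) → Fin (3 + k + n₁)
      leaves = ws ++ (bs ++ us)

      ws-wOnly : ∀ i → wOnly (ws i) ≡ true
      ws-wOnly i = enumerate-sound wOnly _

      bs-both : ∀ i → both (bs i) ≡ true
      bs-both = enumerate-sound both

      us-uOnly : ∀ i → uOnly (us i) ≡ true
      us-uOnly = enumerate-sound uOnly

      uOnly⇒¬Hw : ∀ {x} → uOnly x ≡ true → adj H w x ≡ false
      uOnly⇒¬Hw {x} ux with adj H u x | adj H w x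
      ... | true | false = refl

      uOnly⇒≢w : ∀ {x} → uOnly x ≡ true → x ≢ w
      uOnly⇒≢w {x} ux with adj H u x | adj H w x | x ≟ w
      ... | true | false | no x≢w = x≢w

      rest-Hu : ∀ j → adj H u ((bs ++ us) j) ≡ true
      rest-Hu j with ++-view bs us j
      ... | left c e _ rewrite e = proj₁ (∧-true (bs-both c))
      ... | right d e _ rewrite e = proj₁ (∧-true (us-uOnly d))

      leaves-injective : Injective _≡_ _≡_ leaves
      leaves-injective = ++-injective ws (bs ++ us) ws-inj
        (++-injective bs us (enumerate-injective both) (enumerate-injective uOnly) both∩uOnly)
        wOnly∩rest
        where
        ws-inj : Injective _≡_ _≡_ ws
        ws-inj e = inject≤-injective _ _ _ _ (enumerate-injective wOnly e)
        both∩uOnly : ∀ i j → bs i ≢ us j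
        both∩uOnly i j e
          with () ← trans (sym (proj₂ (∧-true (bs-both i)))) (trans (cong (adj H w) e) (uOnly⇒¬Hw (us-uOnly j)))
        wOnly∩rest : ∀ i j → ws i ≢ (bs ++ us) j
        wOnly∩rest i j e
          with () ← trans (sym (proj₁ (∧-true (ws-wOnly i)))) (trans (cong (adj G u) e) (complement-adj⇒¬adj G (rest-Hu j)))

      leaves≢u : ∀ i → leaves i ≢ u
      leaves≢u i with ++-view ws (bs ++ us) i
      ... | left x e _ = λ e′ → adj⇒≢ G (proj₁ (∧-true (ws-wOnly x))) (sym (trans (sym e) e′))
      ... | right y e _ = λ e′ → adj⇒≢ H (rest-Hu y) (sym (trans (sym e) e′))

      leaves≢w : ∀ i → leaves i ≢ w
      leaves≢w i with ++-view ws (bs ++ us) i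
      ... | left x e _ = λ e′ → adj⇒≢ H (proj₂ (∧-true (ws-wOnly x))) (sym (trans (sym e) e′))
      ... | right y e _ with ++-view bs us y
      ...   | left c e₂ _ = λ e′ → adj⇒≢ H (proj₂ (∧-true (bs-both c))) (sym (trans (sym (trans e e₂)) e′))
      ...   | right d e₂ _ = λ e′ → uOnly⇒≢w (us-uOnly d) (trans (sym (trans e e₂)) e′)

      w-leaves : ∀ i → toℕ i < n₂ → adj H w (leaves i) ≡ true
      w-leaves i i<n₂ with ++-view ws (bs ++ us) i
      ... | left x e _ rewrite e = proj₂ (∧-true (ws-wOnly x))
      ... | right y e i≡a+y with ++-view bs us y
      ...   | left c e₂ _ rewrite e | e₂ = proj₂ (∧-true (bs-both c))
      ...   | right d _ y≡β+d = ⊥-elim (<⇒≱ i<n₂ (begin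
        n₂                   ≤⟨ proj₁ leaf-counts ⟩
        a + β                ≤⟨ +-monoʳ-≤ a (m≤m+n β (toℕ d)) ⟩
        a + (β + toℕ d)      ≡⟨ cong (a +_) y≡β+d ⟨
        a + toℕ y            ≡⟨ i≡a+y ⟨
        toℕ i                ∎))
        where open ≤-Reasoning

      u-leaves : ∀ i → n₂ ≤ toℕ i → adj H u (leaves i) ≡ true
      u-leaves i n₂≤i with ++-view ws (bs ++ us) i
      ... | left x _ i≡x = ⊥-elim (<⇒≱ (<-≤-trans (toℕ<n x) (m⊓n≤n α n₂)) (subst (n₂ ≤_) i≡x n₂≤i))
      ... | right y e _ rewrite e = rest-Hu y

    doubleStar-in-complement : Contains H (DoubleStar n₁ n₂)
    doubleStar-in-complement =
      doubleStar-embedding H u w leaves (proj₂ leaf-counts) leaves-injective leaves≢u leaves≢w Huw w-leaves u-leaves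

upper-bound : ∀ {k n₁ n₂ s} → n₂ ≤ n₁ → s + n₂ ≡ 2 + k → suc k * k < (n₁ + 1) * s →
  RamseyProp (Star (3 + k)) (DoubleStar n₁ n₂) (3 + k + n₁)
upper-bound {k} n₂≤n₁ s+n₂ few-common G with any? (λ c → 2 + k ≤? degree G c)
... | yes (c , high) = inj₁ (star-embedding G c high)
... | no none = let w , Huw , small = small-codegree G degree≤ few-common zero in
  inj₂ (doubleStar-in-complement G degree≤ n₂≤n₁ s+n₂ Huw small)
  where
  degree≤ : ∀ c → degree G c ≤ suc k
  degree≤ c = s≤s⁻¹ (≰⇒> (λ high → none (c , high)))

-- Lower bound

module _ {M K : ℕ} (M≤K : M ≤ K) (G : Graph K) where

  restrict : Graph M
  restrict = record
    { adj = λ i j → adj G (inject≤ i M≤K) (inject≤ j M≤K)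
    ; sym = λ i j → adj-sym G (inject≤ i M≤K) (inject≤ j M≤K)
    ; loopless = λ i → loopless G (inject≤ i M≤K)
    }

  restrict-⊆ : ∀ {k} {F : Graph k} → Contains restrict F → Contains G F
  restrict-⊆ (f , f-inj , f-adj) = (λ i → inject≤ (f i) M≤K) , f-inj ∘ inject≤-injective M≤K M≤K _ _ , f-adj

  complement-restrict-⊆ : ∀ {k} {F : Graph k} → Contains (complement restrict) F → Contains (complement G) F
  complement-restrict-⊆ {F = F} (f , f-inj , f-adj) = (λ i → inject≤ (f i) M≤K) , f-inj ∘ inject≤-injective M≤K M≤K _ _ , lift
    where
    lift : ∀ i j → adj F i j ≡ true → adj (complement G) (inject≤ (f i) M≤K) (inject≤ (f j) M≤K) ≡ true
    lift i j Fij = let e = f-adj i j Fij in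
      ¬adj⇒complement-adj G (adj⇒≢ (complement restrict) e ∘ inject≤-injective M≤K M≤K _ _) (complement-adj⇒¬adj restrict e)

RamseyProp-mono : ∀ {k₁ k₂} {G₁ : Graph k₁} {G₂ : Graph k₂} {M K} → M ≤ K → RamseyProp G₁ G₂ M → RamseyProp G₁ G₂ K
RamseyProp-mono {G₁ = G₁} {G₂} M≤K ramsey G with ramsey (restrict M≤K G)
... | inj₁ G₁⊆ = inj₁ (restrict-⊆ M≤K G {F = G₁} G₁⊆)
... | inj₂ G₂⊆ = inj₂ (complement-restrict-⊆ M≤K G {F = G₂} G₂⊆)

not-Ramsey : ∀ {K d n₁ n₂} (G : Graph K) →
  (∀ c → NeighbourhoodCode G c d) → (∀ c → NeighbourhoodCode (complement G) c n₁) →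
  ∀ {M} → M ≤ K → ¬ RamseyProp (Star (2 + d)) (DoubleStar n₁ n₂) M
not-Ramsey {d = d} {n₁} {n₂} G codes complement-codes M≤K ramsey
  with RamseyProp-mono {G₁ = Star (2 + d)} {G₂ = DoubleStar n₁ n₂} M≤K ramsey G
... | inj₁ star = star-free G codes star
... | inj₂ double-star =
  star-free (complement G) complement-codes
    (Contains-trans {G = complement G} {H = DoubleStar n₁ n₂} {F = Star (2 + n₁)} double-star (doubleStar⊇star n₁ n₂))

no-even-between-doubles : ∀ {K t} → Σ[ e ∈ ℕ ] K ≡ 2 * e → t + t < K → ¬ K < suc t + suc t
no-even-between-doubles {K} {t} (e , K≡2e) 2t<K K<2t+2 =
  even≢odd e t (trans (sym K≡2e) (trans K≡1+2t (cong (λ u → suc (t + u)) (sym (+-identityʳ t)))))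
  where
  K≡1+2t : K ≡ suc (t + t)
  K≡1+2t = ≤-antisym (s≤s⁻¹ (subst (K <_) (cong suc (+-suc t t)) K<2t+2)) 2t<K

module Offset (K : ℕ) where

  offset : ℕ → ℕ → ℕ
  offset c j with c ≤? j
  ... | yes _ = j ∸ c
  ... | no _ = K + j ∸ c

  data OffsetView (c j t : ℕ) : Set where
    forward  : c ≤ j → c + t ≡ j → OffsetView c j t
    backward : j < c → c + t ≡ j + K → OffsetView c j t

  offset-view : ∀ {c} j → c < K → OffsetView c j (offset c j)
  offset-view {c} j c<K with c ≤? j
  ... | yes c≤j = forward c≤j (m+[n∸m]≡n c≤j)
  ... | no c≰j = backward (≰⇒> c≰j) (trans (m+[n∸m]≡n (≤-trans (<⇒≤ c<K) (m≤m+n K j))) (+-comm K j))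

  offset-self : ∀ c → offset c c ≡ 0
  offset-self c with c ≤? c
  ... | yes _ = n∸n≡0 c
  ... | no c≰c = ⊥-elim (c≰c ≤-refl)

  offset-positive : ∀ {c j} → c < K → c ≢ j → 0 < offset c j
  offset-positive {c} {j} c<K c≢j with offset c j | offset-view j c<K
  ... | suc _ | _ = s≤s z≤n
  ... | zero | forward _ e = ⊥-elim (c≢j (trans (sym (+-identityʳ c)) e))
  ... | zero | backward _ e = ⊥-elim (<⇒≱ c<K (subst (K ≤_) (trans (sym e) (+-identityʳ c)) (m≤n+m K j)))

  offset-injective : ∀ {c j j'} → c < K → j < K → j' < K → offset c j ≡ offset c j' → j ≡ j'
  offset-injective {c} {j} {j'} c<K j<K j'<K e with offset-view j c<K | offset-view j' c<K
  ... | forward _ e₁ | forward _ e₂ = trans (sym e₁) (trans (cong (c +_) e) e₂)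
  ... | backward _ e₁ | backward _ e₂ = +-cancelʳ-≡ K j j' (trans (sym e₁) (trans (cong (c +_) e) e₂))
  ... | forward _ e₁ | backward _ e₂ =
    ⊥-elim (<⇒≱ j<K (≤-trans (m≤n+m K j') (≤-reflexive (trans (sym e₂) (trans (cong (c +_) (sym e)) e₁)))))
  ... | backward _ e₁ | forward _ e₂ =
    ⊥-elim (<⇒≱ j'<K (≤-trans (m≤n+m K j) (≤-reflexive (trans (sym e₁) (trans (cong (c +_) e) e₂)))))

  private
    complementary : ∀ {c j t t'} → c + t ≡ j → j + t' ≡ c + K → t + t' ≡ K
    complementary {c} {j} {t} {t'} e₁ e₂ = +-cancelˡ-≡ (c + j) _ _ (begin
      c + j + (t + t')     ≡⟨ solve c j t t' ⟩
      (c + t) + (j + t')   ≡⟨ cong₂ _+_ e₁ e₂ ⟩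
      j + (c + K)          ≡⟨ solve′ j c K ⟩
      c + j + K            ∎)
      where
      open ≡-Reasoning
      solve : ∀ c j t t' → c + j + (t + t') ≡ (c + t) + (j + t')
      solve = solve-∀
      solve′ : ∀ j c K → j + (c + K) ≡ c + j + K
      solve′ = solve-∀

  offset-sum : ∀ {c j} → c < K → j < K → c ≢ j → offset c j + offset j c ≡ K
  offset-sum {c} {j} c<K j<K c≢j with offset-view j c<K | offset-view c j<K
  ... | forward c≤j _ | forward j≤c _ = ⊥-elim (c≢j (≤-antisym c≤j j≤c))
  ... | backward j<c _ | backward c<j _ = ⊥-elim (<-asym j<c c<j)
  ... | forward _ e₁ | backward _ e₂ = complementary e₁ e₂
  ... | backward _ e₁ | forward _ e₂ = trans (+-comm (offset c j) (offset j c)) (complementary e₂ e₁)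

-- The circulant graph on ℤ/K joining c and j when j − c ≡ ±t with 1 ≤ t ≤ h, or when b holds and j − c is
-- the antipode of 0.
module Circulant (h n₁ : ℕ) (b : Bool) where

  K : ℕ
  K = suc (h + h + χ b + n₁)

  connection : ℕ → Bool
  connection t = (⌊ 1 ≤? t ⌋ ∧ ⌊ t ≤? h ⌋) ∨ (b ∧ ⌊ t + t ≟ℕ K ⌋)

  connection-true : ∀ {t} → connection t ≡ true → (1 ≤ t × t ≤ h) ⊎ (b ≡ true × t + t ≡ K)
  connection-true {t} e with 1 ≤? t | t ≤? h | t + t ≟ℕ K
  ... | yes 1≤t | yes t≤h | _ = inj₁ (1≤t , t≤h)
  ... | yes _ | no _ | yes 2t≡K = inj₂ (proj₁ (∧-true e) , 2t≡K)
  ... | no _ | _ | yes 2t≡K = inj₂ (proj₁ (∧-true e) , 2t≡K)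
  ... | yes _ | no _ | no _ with () ← trans (sym e) (∧-zeroʳ b)
  ... | no _ | _ | no _ with () ← trans (sym e) (∧-zeroʳ b)

  connection-false : ∀ {t} → connection t ≡ false → 1 ≤ t → h < t × (b ≡ true → t + t ≢ K)
  connection-false {t} e 1≤t with 1 ≤? t | t ≤? h | t + t ≟ℕ K
  ... | no 1≰t | _ | _ = ⊥-elim (1≰t 1≤t)
  ... | yes _ | no t≰h | yes _ = ≰⇒> t≰h , λ b≡true _ → contradiction (trans (sym e) (cong (_∧ true) b≡true)) λ ()
  ... | yes _ | no t≰h | no 2t≢K = ≰⇒> t≰h , λ _ → 2t≢K

  private
    dec-true-⇒ : ∀ {P : Set} (d : Dec P) → ⌊ d ⌋ ≡ true → P
    dec-true-⇒ (yes p) _ = p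

    dec-false-⇒ : ∀ {P : Set} (d : Dec P) → ⌊ d ⌋ ≡ false → ¬ P
    dec-false-⇒ (no ¬p) _ = ¬p

  nearCode : ℕ → ℕ → ℕ
  nearCode t t' with t ≤? h | t' ≤? h
  ... | yes _ | _ = pred t
  ... | no _ | yes _ = h + pred t'
  ... | no _ | no _ = h + h

  nearCode-low : ∀ {t t'} → t ≤ h → nearCode t t' ≡ pred t
  nearCode-low {t} t≤h with t ≤? h
  ... | yes _ = refl
  ... | no t≰h = ⊥-elim (t≰h t≤h)

  nearCode-high : ∀ {t t'} → ¬ t ≤ h → t' ≤ h → nearCode t t' ≡ h + pred t'
  nearCode-high {t} {t'} t≰h t'≤h with t ≤? h | t' ≤? h
  ... | yes t≤h | _ = ⊥-elim (t≰h t≤h)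
  ... | no _ | yes _ = refl
  ... | no _ | no t'≰h = ⊥-elim (t'≰h t'≤h)

  nearCode-middle : ∀ {t t'} → ¬ t ≤ h → ¬ t' ≤ h → nearCode t t' ≡ h + h
  nearCode-middle {t} {t'} t≰h t'≰h with t ≤? h | t' ≤? h
  ... | yes t≤h | _ = ⊥-elim (t≰h t≤h)
  ... | no _ | yes t'≤h = ⊥-elim (t'≰h t'≤h)
  ... | no _ | no _ = refl

  data Near (t t' : ℕ) : Set where
    low    : 1 ≤ t → t ≤ h → nearCode t t' ≡ pred t → Near t t'
    high   : 1 ≤ t' → t' ≤ h → nearCode t t' ≡ h + pred t' → Near t t'
    middle : b ≡ true → t + t ≡ K → nearCode t t' ≡ h + h → Near t t'

  midpoint : ∀ {t t'} → t + t' ≡ K → ¬ t ≤ h → ¬ t' ≤ h → connection t ∨ connection t' ≡ true → b ≡ true × t + t ≡ K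
  midpoint {t} {t'} t+t' t≰h t'≰h e with connection t in ct
  ... | true with connection-true ct
  ...   | inj₁ (_ , t≤h) = ⊥-elim (t≰h t≤h)
  ...   | inj₂ mid = mid
  midpoint {t} {t'} t+t' t≰h t'≰h e | false with connection-true e
  ...   | inj₁ (_ , t'≤h) = ⊥-elim (t'≰h t'≤h)
  ...   | inj₂ (b≡true , 2t'≡K) = b≡true , trans (cong (t +_) t≡t') t+t'
    where
    t≡t' : t ≡ t'
    t≡t' = +-cancelʳ-≡ t' t t' (trans t+t' (sym 2t'≡K))

  near : ∀ {t t'} → t + t' ≡ K → 1 ≤ t → 1 ≤ t' → connection t ∨ connection t' ≡ true → Near t t'
  near {t} {t'} t+t' 1≤t 1≤t' e = by-cases (λ t≰h t'≰h → midpoint t+t' t≰h t'≰h e)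
    where
    by-cases : (¬ t ≤ h → ¬ t' ≤ h → b ≡ true × t + t ≡ K) → Near t t'
    by-cases mid with t ≤? h | t' ≤? h
    ... | yes t≤h | _ = low 1≤t t≤h (nearCode-low t≤h)
    ... | no t≰h | yes t'≤h = high 1≤t' t'≤h (nearCode-high t≰h t'≤h)
    ... | no t≰h | no t'≰h = let b≡true , 2t≡K = mid t≰h t'≰h in middle b≡true 2t≡K (nearCode-middle t≰h t'≰h)

  private
    pred-inverse : ∀ {t} → 1 ≤ t → suc (pred t) ≡ t
    pred-inverse {suc t} _ = refl

    pred-<h : ∀ {t} → 1 ≤ t → t ≤ h → pred t < h
    pred-<h {suc t} _ t<h = t<h

    double-injective : ∀ {t t'} → t + t ≡ t' + t' → t ≡ t'
    double-injective {t} {t'} e with <-cmp t t'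
    ... | tri< t<t' _ _ = ⊥-elim (<-irrefl e (+-mono-< t<t' t<t'))
    ... | tri≈ _ t≡t' _ = t≡t'
    ... | tri> _ _ t>t' = ⊥-elim (<-irrefl (sym e) (+-mono-< t>t' t>t'))

    2h≤ : h + h ≤ h + h + χ b
    2h≤ = m≤m+n (h + h) (χ b)

  nearCode-< : ∀ {t t'} → Near t t' → nearCode t t' < h + h + χ b
  nearCode-< (low 1≤t t≤h e) rewrite e = <-≤-trans (pred-<h 1≤t t≤h) (≤-trans (m≤m+n h h) 2h≤)
  nearCode-< (high 1≤t' t'≤h e) rewrite e = <-≤-trans (+-monoʳ-< h (pred-<h 1≤t' t'≤h)) 2h≤
  nearCode-< (middle b≡true _ e) rewrite e | b≡true = m<m+n (h + h) (s≤s z≤n)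

  nearCode-injective : ∀ {t₁ t₁' t₂ t₂'} → Near t₁ t₁' → Near t₂ t₂' → t₁ + t₁' ≡ K → t₂ + t₂' ≡ K →
    nearCode t₁ t₁' ≡ nearCode t₂ t₂' → t₁ ≡ t₂
  nearCode-injective (low 1≤t₁ _ e₁) (low 1≤t₂ _ e₂) _ _ e =
    trans (sym (pred-inverse 1≤t₁)) (trans (cong suc (trans (sym e₁) (trans e e₂))) (pred-inverse 1≤t₂))
  nearCode-injective {t₁} {t₁'} {t₂} {t₂'} (high 1≤t₁' _ e₁) (high 1≤t₂' _ e₂) s₁ s₂ e =
    +-cancelʳ-≡ t₁' t₁ t₂ (trans s₁ (trans (sym s₂) (cong (t₂ +_) (sym t₁'≡t₂'))))
    where
    t₁'≡t₂' : t₁' ≡ t₂'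
    t₁'≡t₂' = trans (sym (pred-inverse 1≤t₁'))
      (trans (cong suc (+-cancelˡ-≡ h _ _ (trans (sym e₁) (trans e e₂)))) (pred-inverse 1≤t₂'))
  nearCode-injective (middle _ 2t₁≡K _) (middle _ 2t₂≡K _) _ _ _ = double-injective (trans 2t₁≡K (sym 2t₂≡K))
  nearCode-injective (low 1≤t t≤h e₁) (high _ _ e₂) _ _ e =
    ⊥-elim (<⇒≢ (<-≤-trans (pred-<h 1≤t t≤h) (m≤m+n h _)) (trans (sym e₁) (trans e e₂)))
  nearCode-injective (high _ _ e₁) (low 1≤t t≤h e₂) _ _ e =
    ⊥-elim (<⇒≢ (<-≤-trans (pred-<h 1≤t t≤h) (m≤m+n h _)) (trans (sym e₂) (trans (sym e) e₁)))
  nearCode-injective (low 1≤t t≤h e₁) (middle _ _ e₂) _ _ e =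
    ⊥-elim (<⇒≢ (<-≤-trans (pred-<h 1≤t t≤h) (m≤m+n h h)) (trans (sym e₁) (trans e e₂)))
  nearCode-injective (middle _ _ e₁) (low 1≤t t≤h e₂) _ _ e =
    ⊥-elim (<⇒≢ (<-≤-trans (pred-<h 1≤t t≤h) (m≤m+n h h)) (trans (sym e₂) (trans (sym e) e₁)))
  nearCode-injective (high 1≤t' t'≤h e₁) (middle _ _ e₂) _ _ e =
    ⊥-elim (<⇒≢ (+-monoʳ-< h (pred-<h 1≤t' t'≤h)) (trans (sym e₁) (trans e e₂)))
  nearCode-injective (middle _ _ e₁) (high 1≤t' t'≤h e₂) _ _ e =
    ⊥-elim (<⇒≢ (+-monoʳ-< h (pred-<h 1≤t' t'≤h)) (trans (sym e₂) (trans (sym e) e₁)))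

  K-with-midpoint : b ≡ true → K ≡ 2 + (h + h + n₁)
  K-with-midpoint b≡true rewrite b≡true = solve h n₁
    where
    solve : ∀ h n₁ → suc (h + h + 1 + n₁) ≡ 2 + (h + h + n₁)
    solve = solve-∀

  -- Non-neighbour offsets t satisfy h < t < K − h and avoid the antipode, so shifting them down by h + 1,
  -- and by one more beyond the antipode, lands below n₁.
  farCode : ℕ → ℕ
  farCode t = t ∸ (suc h + χ (b ∧ ⌊ K <? t + t ⌋))

  data Far (t : ℕ) : Set where
    below : ∀ r → t ≡ suc h + r → (b ≡ true → t + t < K) → farCode t ≡ r → Far t
    above : ∀ r → t ≡ 2 + h + r → b ≡ true → K < t + t → farCode t ≡ r → Far t

  far : ∀ {t} → connection t ≡ false → 1 ≤ t → Far t
  far {t} e 1≤t with connection-false e 1≤t | b ∧ ⌊ K <? t + t ⌋ in shifted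
  ... | h<t , 2t≢K | false =
    below (t ∸ suc h) (sym (m+[n∸m]≡n h<t)) 2t<K
      (trans (cong (λ z → t ∸ (suc h + χ z)) shifted) (cong (t ∸_) (+-identityʳ (suc h))))
    where
    2t<K : b ≡ true → t + t < K
    2t<K b≡true =
      ≤∧≢⇒< (≮⇒≥ (dec-false-⇒ (K <? t + t) (trans (cong (_∧ ⌊ K <? t + t ⌋) (sym b≡true)) shifted))) (2t≢K b≡true)
  ... | h<t , 2t≢K | true =
    above (t ∸ (2 + h)) (sym (m+[n∸m]≡n 2+h≤t)) b≡true K<2t
      (trans (cong (λ z → t ∸ (suc h + χ z)) shifted) (cong (t ∸_) (+-comm (suc h) 1)))
    where
    b≡true : b ≡ true
    b≡true = proj₁ (∧-true shifted)
    K<2t : K < t + t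
    K<2t = dec-true-⇒ (K <? t + t) (proj₂ (∧-true shifted))
    2+h≤t : 2 + h ≤ t
    2+h≤t = ≰⇒> λ t≤1+h → <⇒≱ K<2t (begin
      t + t               ≤⟨ +-mono-≤ t≤1+h t≤1+h ⟩
      suc h + suc h       ≡⟨ cong suc (+-suc h h) ⟩
      2 + (h + h)         ≤⟨ s≤s (s≤s (m≤m+n (h + h) n₁)) ⟩
      2 + (h + h + n₁)    ≡⟨ K-with-midpoint b≡true ⟨
      K                   ∎)
      where open ≤-Reasoning

  farCode-< : ∀ {t t'} → Far t → t + t' ≡ K → h < t' → farCode t < n₁
  farCode-< {t} {t'} (below r refl 2t<K e) t+t' h<t' rewrite e with true-or-false b
  ... | inj₁ b≡true = ≤-<-trans (m≤m+n r r) (s≤s⁻¹ (s≤s⁻¹ (+-cancelˡ-≤ (h + h) _ _ (begin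
      h + h + (3 + (r + r))              ≡⟨ solve₁ h r ⟩
      suc (suc h + r + (suc h + r))      ≤⟨ 2t<K b≡true ⟩
      K                                  ≡⟨ K-with-midpoint b≡true ⟩
      2 + (h + h + n₁)                   ≡⟨ solve₂ h n₁ ⟩
      h + h + (2 + n₁)                   ∎))))
    where
    open ≤-Reasoning
    solve₁ : ∀ h r → h + h + (3 + (r + r)) ≡ suc (suc h + r + (suc h + r))
    solve₁ = solve-∀
    solve₂ : ∀ h n₁ → 2 + (h + h + n₁) ≡ h + h + (2 + n₁)
    solve₂ = solve-∀
  ... | inj₂ b≡false = s≤s⁻¹ (+-cancelˡ-≤ (h + h) _ _ (begin
      h + h + (2 + r)                    ≡⟨ solve₁ h r ⟩
      suc h + r + suc h                  ≤⟨ +-monoʳ-≤ (suc h + r) h<t' ⟩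
      suc h + r + t'                     ≡⟨ t+t' ⟩
      K                                  ≡⟨ cong (λ z → suc (h + h + χ z + n₁)) b≡false ⟩
      suc (h + h + 0 + n₁)               ≡⟨ solve₂ h n₁ ⟩
      h + h + (1 + n₁)                   ∎))
    where
    open ≤-Reasoning
    solve₁ : ∀ h r → h + h + (2 + r) ≡ suc h + r + suc h
    solve₁ = solve-∀
    solve₂ : ∀ h n₁ → suc (h + h + 0 + n₁) ≡ h + h + (1 + n₁)
    solve₂ = solve-∀
  farCode-< {t} {t'} (above r refl b≡true _ e) t+t' h<t' rewrite e = s≤s⁻¹ (s≤s⁻¹ (+-cancelˡ-≤ (h + h) _ _ (begin
      h + h + (3 + r)                    ≡⟨ solve₁ h r ⟩
      2 + h + r + suc h                  ≤⟨ +-monoʳ-≤ (2 + h + r) h<t' ⟩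
      2 + h + r + t'                     ≡⟨ t+t' ⟩
      K                                  ≡⟨ K-with-midpoint b≡true ⟩
      2 + (h + h + n₁)                   ≡⟨ solve₂ h n₁ ⟩
      h + h + (2 + n₁)                   ∎)))
    where
    open ≤-Reasoning
    solve₁ : ∀ h r → h + h + (3 + r) ≡ 2 + h + r + suc h
    solve₁ = solve-∀
    solve₂ : ∀ h n₁ → 2 + (h + h + n₁) ≡ h + h + (2 + n₁)
    solve₂ = solve-∀

  farCode-injective : (b ≡ true → Σ[ e ∈ ℕ ] K ≡ 2 * e) →
    ∀ {t₁ t₂} → Far t₁ → Far t₂ → farCode t₁ ≡ farCode t₂ → t₁ ≡ t₂
  farCode-injective _ (below r₁ refl _ e₁) (below r₂ refl _ e₂) e = cong (suc h +_) (trans (sym e₁) (trans e e₂))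
  farCode-injective _ (above r₁ refl _ _ e₁) (above r₂ refl _ _ e₂) e = cong (2 + h +_) (trans (sym e₁) (trans e e₂))
  farCode-injective K-even (below r₁ refl 2t₁<K e₁) (above r₂ refl b≡true K<2t₂ e₂) e =
    ⊥-elim (no-even-between-doubles {t = suc h + r₁} (K-even b≡true) (2t₁<K b≡true)
      (subst (λ r → K < suc (suc h + r) + suc (suc h + r)) (trans (sym e₂) (trans (sym e) e₁)) K<2t₂))
  farCode-injective K-even (above r₁ refl b≡true K<2t₁ e₁) (below r₂ refl 2t₂<K e₂) e =
    ⊥-elim (no-even-between-doubles {t = suc h + r₂} (K-even b≡true) (2t₂<K b≡true)
      (subst (λ r → K < suc (suc h + r) + suc (suc h + r)) (trans (sym e₁) (trans e e₂)) K<2t₁))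

  open Offset K

  adjacent : ℕ → ℕ → Bool
  adjacent c j = connection (offset c j) ∨ connection (offset j c)

  circulant : Graph K
  circulant = record
    { adj = λ i j → adjacent (toℕ i) (toℕ j)
    ; sym = λ i j → ∨-comm (connection (offset (toℕ i) (toℕ j))) _
    ; loopless = λ i → cong₂ _∨_ (no-loop (toℕ i)) (no-loop (toℕ i))
    }
    where
    no-loop : ∀ c → connection (offset c c) ≡ false
    no-loop c rewrite offset-self c = ∧-zeroʳ b

  module _ (c : Fin K) where

    private
      distinct : ∀ (G : Graph K) {j} → adj G c j ≡ true → toℕ c ≢ toℕ j
      distinct G cj = adj⇒≢ G cj ∘ toℕ-injective

      offsets-sum : ∀ {j} → toℕ c ≢ toℕ j → offset (toℕ c) (toℕ j) + offset (toℕ j) (toℕ c) ≡ K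
      offsets-sum {j} = offset-sum (toℕ<n c) (toℕ<n j)

      offsets-positive : ∀ {j} → toℕ c ≢ toℕ j → 1 ≤ offset (toℕ c) (toℕ j) × 1 ≤ offset (toℕ j) (toℕ c)
      offsets-positive {j} c≢j = offset-positive (toℕ<n c) c≢j , offset-positive (toℕ<n j) (c≢j ∘ sym)

      neighbour-view : ∀ {j} → adj circulant c j ≡ true → Near (offset (toℕ c) (toℕ j)) (offset (toℕ j) (toℕ c))
      neighbour-view cj = let p , p' = offsets-positive (distinct circulant cj) in near (offsets-sum (distinct circulant cj)) p p' cj

    neighbourhood-code : NeighbourhoodCode circulant c (h + h + χ b)
    neighbourhood-code = record
      { code = λ j → nearCode (offset (toℕ c) (toℕ j)) (offset (toℕ j) (toℕ c))
      ; code-< = nearCode-< ∘ neighbour-view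
      ; code-inj = λ {j} {j'} cj cj' e → toℕ-injective (offset-injective (toℕ<n c) (toℕ<n j) (toℕ<n j')
          (nearCode-injective (neighbour-view cj) (neighbour-view cj')
            (offsets-sum (distinct circulant cj)) (offsets-sum (distinct circulant cj')) e))
      }

    private
      non-neighbour-view : ∀ {j} → adj (complement circulant) c j ≡ true →
        Far (offset (toℕ c) (toℕ j)) × h < offset (toℕ j) (toℕ c)
      non-neighbour-view {j} cj =
        let c≢j = distinct (complement circulant) cj
            p , p' = offsets-positive c≢j
            far₁ , far₂ = ∨-false {connection (offset (toℕ c) (toℕ j))} (complement-adj⇒¬adj circulant {c} {j} cj)
        in far far₁ p , proj₁ (connection-false far₂ p')

    complement-neighbourhood-code : (b ≡ true → Σ[ e ∈ ℕ ] K ≡ 2 * e) → NeighbourhoodCode (complement circulant) c n₁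
    complement-neighbourhood-code K-even = record
      { code = λ j → farCode (offset (toℕ c) (toℕ j))
      ; code-< = λ cj → let v , h<t' = non-neighbour-view cj in farCode-< v (offsets-sum (distinct (complement circulant) cj)) h<t'
      ; code-inj = λ {j} {j'} cj cj' e → toℕ-injective (offset-injective (toℕ<n c) (toℕ<n j) (toℕ<n j')
          (farCode-injective K-even (proj₁ (non-neighbour-view cj)) (proj₁ (non-neighbour-view cj')) e))
      }

halve : ∀ n → Σ[ h ∈ ℕ ] Σ[ b ∈ Bool ] n ≡ h + h + χ b
halve zero = 0 , false , refl
halve (suc zero) = 0 , true , refl
halve (suc (suc n)) with halve n
... | h , b , n≡ = suc h , b , trans (cong (λ t → suc (suc t)) n≡) (solve h (χ b))
  where
  solve : ∀ h c → suc (suc (h + h + c)) ≡ suc h + suc h + c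
  solve = solve-∀

odd*n₁-even⇒order-even : ∀ {h n₁} → 2 ∣ (2 + (h + h + 1)) * n₁ → Σ[ e ∈ ℕ ] suc (h + h + 1 + n₁) ≡ 2 * e
odd*n₁-even⇒order-even {h} {n₁} 2∣m*n₁ with ∣m+n∣m⇒∣n (subst (2 ∣_) (solve₁ h n₁) 2∣m*n₁) (m∣m*n ((h + 1) * n₁))
  where
  solve₁ : ∀ h n₁ → (2 + (h + h + 1)) * n₁ ≡ 2 * ((h + 1) * n₁) + n₁
  solve₁ = solve-∀
... | divides q refl = h + 1 + q , solve₂ h q
  where
  solve₂ : ∀ h q → suc (h + h + 1 + q * 2) ≡ 2 * (h + 1 + q)
  solve₂ = solve-∀

lower-bound : ∀ {k n₁ n₂} → 2 ∣ (3 + k) * n₁ → ∀ {M} → M < 3 + k + n₁ →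
  ¬ RamseyProp (Star (3 + k)) (DoubleStar n₁ n₂) M
lower-bound {k} {n₁} {n₂} 2∣m*n₁ {M} M<N with halve (suc k)
... | h , b , 1+k≡ = subst (λ d → ¬ RamseyProp (Star (2 + d)) (DoubleStar n₁ n₂) M) (sym 1+k≡)
  (not-Ramsey circulant neighbourhood-code (λ c → complement-neighbourhood-code c K-even) M≤K)
  where
  open Circulant h n₁ b
  M≤K : M ≤ K
  M≤K = subst (M ≤_) (cong (λ d → suc (d + n₁)) 1+k≡) (s≤s⁻¹ M<N)
  K-even : b ≡ true → Σ[ e ∈ ℕ ] K ≡ 2 * e
  K-even b≡true = subst (λ c → Σ[ e ∈ ℕ ] suc (h + h + χ c + n₁) ≡ 2 * e) (sym b≡true)
    (odd*n₁-even⇒order-even {h} {n₁} (subst (λ d → 2 ∣ (2 + d) * n₁) (trans 1+k≡ (cong (λ c → h + h + χ c) b≡true)) 2∣m*n₁))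

decompose : ∀ {m n₂} → 2 ≤ n₂ → n₂ + 2 ≤ m → Σ[ p ∈ ℕ ] Σ[ s ∈ ℕ ] n₂ ≡ 2 + p × m ≡ 3 + (s + p)
decompose {m} {suc (suc p)} (s≤s (s≤s z≤n)) n₂+2≤m =
  p , suc (m ∸ (suc (suc p) + 2)) , refl , trans (sym (m+[n∸m]≡n n₂+2≤m)) (solve p (m ∸ (suc (suc p) + 2)))
  where
  solve : ∀ p q → suc (suc p) + 2 + q ≡ 3 + (suc q + p)
  solve = solve-∀

few-common-neighbours : ∀ {s p n₁} → (3 + (s + p) + (2 + p)) * s + suc p * p < (n₁ + 5) * s →
  suc (s + p) * (s + p) < (n₁ + 1) * s
few-common-neighbours {s} {p} {n₁} bound = +-cancelʳ-< (4 * s) _ _ (subst₂ _<_ (solve₁ s p) (solve₂ n₁ s) bound)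
  where
  solve₁ : ∀ s p → (3 + (s + p) + (2 + p)) * s + suc p * p ≡ suc (s + p) * (s + p) + 4 * s
  solve₁ = solve-∀
  solve₂ : ∀ n₁ s → (n₁ + 5) * s ≡ (n₁ + 1) * s + 4 * s
  solve₂ = solve-∀

theorem4p1 : (m n₁ n₂ : ℕ) → 2 ≤ n₂ → n₂ + 2 ≤ m → m ≤ n₁ + 2 → 2 ∣ m * n₁ →
    (m + n₂) * (m ∸ 1 ∸ n₂) + (n₂ ∸ 1) * (n₂ ∸ 2) < (n₁ + 5) * (m ∸ 1 ∸ n₂) →
    RamseyNumberIs (Star m) (DoubleStar n₁ n₂) (m + n₁)
theorem4p1 m n₁ n₂ 2≤n₂ n₂+2≤m m≤n₁+2 2∣m*n₁ bound with decompose 2≤n₂ n₂+2≤m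
... | p , s , refl , refl rewrite m+n∸n≡m s p =
  s≤s z≤n ,
  upper-bound (+-cancelʳ-≤ 2 _ _ (≤-trans n₂+2≤m m≤n₁+2)) (solve s p) (few-common-neighbours {s} {p} {n₁} bound) ,
  λ M _ M<N → lower-bound 2∣m*n₁ M<N
  where
  solve : ∀ s p → s + (2 + p) ≡ 2 + (s + p)
  solve = solve-∀
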